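{- Let $G\in\mathcal G$ and let $\hat\nu$ be a finite non-self-touching path of the facial graph $\widehat G$. Then there exists a subsequence of $\hat\nu$ with the same endvertices that forms a non-self-touching path of the matching graph $G_*$.
   Context: A plane graph is a graph embedded in $\mathbb R^2$ so that edges cross only at vertices. $\mathcal G$ denotes the class of countably infinite, locally finite, $2$-connected, simple plane graphs embedded in $\mathbb R^2$ with no vertex-accumulation points and no edge-accumulation points, and such that every face has finite Euclidean diameter; the boundary $\partial F$ of each face $F$ is a cycle. The matching graph $G_*$ is obtained from $G$ by adding, inside every non-triangular face $F$, an edge (diagonal) between every pair of non-adjacent vertices of $\partial F$. The facial graph $\widehat G$ is obtained from $G$ by adding inside each non-triangular face $F$ a new vertex $\phi(F)$ joined by an edge to every vertex of $\partial F$. A path $(\pi_0,\dots,\pi_n)$ is non-self-touching if $\pi_i\sim\pi_j$ holds if and only if $|i-j|=1$. -}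

module Defs where

open import Data.Nat using (ℕ; suc; _≤_)
open import Data.Fin using (Fin; toℕ)
open import Data.List using (List; length; lookup; head; last)
open import Data.List.Membership.Propositional using (_∈_)
open import Data.List.Relation.Unary.All using (All)
open import Data.List.Relation.Unary.Linked using (Linked)
open import Data.List.Relation.Unary.Unique.Propositional using (Unique)
open import Data.Maybe using (Maybe; just)
open import Data.Product using (Σ; _×_; ∃; _,_)
open import Data.Sum using (_⊎_; inj₁; inj₂)
open import Data.Empty using (⊥)
open import Relation.Nullary using (¬_)
open import Relation.Binary.PropositionalEquality using (_≡_; _≢_)
open import Function.Bundles using (_↔_; _⇔_)

record WalkFromTo {A : Set} (R : A → A → Set) (u v : A) (xs : List A) : Set where
  field
    linked : Linked R xs
    start  : head xs ≡ just u
    end    : last xs ≡ just v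

record IsPath {A : Set} (R : A → A → Set) (xs : List A) : Set where
  field
    nonempty : 1 ≤ length xs
    linked   : Linked R xs
    distinct : Unique xs

NonSelfTouching : {A : Set} (R : A → A → Set) (xs : List A) → Set
NonSelfTouching R xs =
  (i j : Fin (length xs)) →
  R (lookup xs i) (lookup xs j) ⇔ (suc (toℕ i) ≡ toℕ j ⊎ suc (toℕ j) ≡ toℕ i)

record NSTPath {A : Set} (R : A → A → Set) (xs : List A) : Set where
  field
    path : IsPath R xs
    nst  : NonSelfTouching R xs

record IsCycle {A : Set} (R : A → A → Set) (xs : List A) : Set where
  field
    length≥3 : 3 ≤ length xs
    linked   : Linked R xs
    distinct : Unique xs
    closing  : ∀ {a b} → head xs ≡ just a → last xs ≡ just b → R b a

-- 2-connected: at least 3 vertices (supplied by infiniteness below) and removing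
-- any single vertex x leaves the graph connected.
TwoConnected : {A : Set} (R : A → A → Set) → Set
TwoConnected {A} R =
  (x u v : A) → u ≢ x → v ≢ x →
  ∃ λ (ws : List A) → WalkFromTo R u v ws × All (λ w → w ≢ x) ws

record PlaneGraph : Set₁ where
  field
    V        : Set
    _~_      : V → V → Set
    ~-sym    : ∀ {u v} → u ~ v → v ~ u
    ~-irrefl : ∀ {v} → ¬ (v ~ v)
    enum     : V ↔ ℕ
    nbrs      : V → List V
    nbrs-spec : ∀ u v → (u ~ v) ⇔ (v ∈ nbrs u)
    twoConn  : TwoConnected _~_
    Face          : Set
    boundary      : Face → List V
    boundary-cyc  : ∀ F → IsCycle _~_ (boundary F)
    facesAt       : V → List Face
    facesAt-spec  : ∀ v F → (v ∈ boundary F) ⇔ (F ∈ facesAt v)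

  NonTriangular : Face → Set
  NonTriangular F = ¬ (length (boundary F) ≡ 3)

  _~*_ : V → V → Set
  u ~* v = u ~ v ⊎
           Σ Face (λ F → NonTriangular F × u ∈ boundary F × v ∈ boundary F × u ≢ v)

  V̂ : Set
  V̂ = V ⊎ Σ Face NonTriangular

  _~̂_ : V̂ → V̂ → Set
  inj₁ u ~̂ inj₁ v = u ~ v
  inj₁ u ~̂ inj₂ (F , _) = u ∈ boundary F
  inj₂ (F , _) ~̂ inj₁ v = v ∈ boundary F
  inj₂ _ ~̂ inj₂ _ = ⊥

{-# OPTIONS --safe #-}
-- Replacing every facial vertex φ(F) of ν̂ by the diagonal of F joining its two
-- neighbours on ν̂ (distinct, since ν̂ is a path) turns ν̂ into a walk of G_* through
-- the G-vertices of ν̂, in order.  A walk in a graph with decidable adjacency contains,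
-- as a subsequence with the same ends, a chordless path: going backwards along the
-- walk, prepend each vertex to the chordless path built so far, cut at the last
-- neighbour of that vertex on it.  Adjacency in G_* is decidable because V ≅ ℕ and
-- every vertex lies on finitely many faces.
module Submission where

open import Defs
open import Data.Empty using (⊥-elim)
open import Data.Fin using (zero; suc)
open import Data.List using (List; []; _∷_; map; head; last; length)
open import Data.List.Membership.Propositional using (_∈_; find; lose)
open import Data.List.Membership.Propositional.Properties using (∈-lookup)
import Data.List.Membership.DecPropositional as DecMembership
open import Data.List.Relation.Binary.Sublist.Propositional
  using (_⊆_; _⊇_; []; _∷_; _∷ʳ_; ⊆-refl; ⊆-trans)
open import Data.List.Relation.Binary.Sublist.Propositional.Properties
  using (All-resp-⊆; map⁺)
open import Data.List.Relation.Unary.All as All using (All; _∷_)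
open import Data.List.Relation.Unary.All.Properties using (¬Any⇒All¬)
open import Data.List.Relation.Unary.AllPairs using (AllPairs; []; _∷_)
open import Data.List.Relation.Unary.Any as Any using (Any; here; any?)
open import Data.List.Relation.Unary.Linked using (Linked; [-]; _∷_)
open import Data.List.Relation.Unary.Unique.Propositional using (Unique)
import Data.List.Relation.Unary.Unique.Propositional.Properties as Unique
open import Data.Maybe using (just)
open import Data.Nat using (ℕ; s≤s; z≤n)
import Data.Nat as ℕ
open import Data.Nat.Properties using (suc-injective)
open import Data.Product using (Σ; ∃; _×_; _,_)
open import Data.Sum as Sum using (_⊎_; inj₁; inj₂)
open import Function using (_∘_; const)
open import Function.Bundles using (_⇔_; mk⇔; Equivalence)
open import Function.Construct.Composition using (_⇔-∘_)
open import Function.Construct.Symmetry using (⇔-sym)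
open import Function.Properties.Inverse using (↔⇒↣)
open import Relation.Binary.Definitions using (Symmetric; Decidable; DecidableEquality; _Respects_)
open import Relation.Binary.PropositionalEquality using (_≡_; _≢_; refl; sym; cong; trans)
open import Relation.Nullary using (¬_; ¬?; Dec; yes; no)
import Relation.Nullary.Decidable as Dec
open import Relation.Nullary.Decidable using (_×-dec_; _⊎-dec_; via-injection)

AllPairs-resp-⊆ : {A : Set} {S : A → A → Set} → AllPairs S Respects _⊇_
AllPairs-resp-⊆ [] [] = []
AllPairs-resp-⊆ (_ ∷ʳ τ) (_ ∷ pxs) = AllPairs-resp-⊆ τ pxs
AllPairs-resp-⊆ (refl ∷ τ) (px ∷ pxs) = All-resp-⊆ τ px ∷ AllPairs-resp-⊆ τ pxs

Adjacent : ℕ → ℕ → Set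
Adjacent i j = ℕ.suc i ≡ j ⊎ ℕ.suc j ≡ i

Adjacent-suc : ∀ {i j} → Adjacent i j ⇔ Adjacent (ℕ.suc i) (ℕ.suc j)
Adjacent-suc = mk⇔ (Sum.map (cong ℕ.suc) (cong ℕ.suc)) (Sum.map suc-injective suc-injective)

¬Adjacent-0-0 : ¬ Adjacent 0 0
¬Adjacent-0-0 (inj₁ ())
¬Adjacent-0-0 (inj₂ ())

¬Adjacent-0-2+ : ∀ {k} → ¬ Adjacent 0 (ℕ.suc (ℕ.suc k))
¬Adjacent-0-2+ (inj₁ ())
¬Adjacent-0-2+ (inj₂ ())

⇔-by-refutation : {P Q : Set} → ¬ P → ¬ Q → P ⇔ Q
⇔-by-refutation ¬p ¬q = mk⇔ (⊥-elim ∘ ¬p) (⊥-elim ∘ ¬q)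

data Chordless {A : Set} (R : A → A → Set) : List A → Set where
  [_]    : ∀ x → Chordless R (x ∷ [])
  extend : ∀ {x y zs} → R x y → All (¬_ ∘ R x) zs → Chordless R (y ∷ zs) →
           Chordless R (x ∷ y ∷ zs)

module _ {A : Set} {R : A → A → Set} where

  Chordless⇒Linked : ∀ {xs} → Chordless R xs → Linked R xs
  Chordless⇒Linked [ x ] = [-]
  Chordless⇒Linked (extend x~y _ c) = x~y ∷ Chordless⇒Linked c

  module _ (R-sym : Symmetric R) (R-irrefl : ∀ {x} → ¬ R x x) where

    Chordless⇒NonSelfTouching : ∀ {xs} → Chordless R xs → NonSelfTouching R xs
    Chordless⇒NonSelfTouching [ x ] zero zero = ⇔-by-refutation R-irrefl ¬Adjacent-0-0
    Chordless⇒NonSelfTouching (extend _ _ _) zero zero = ⇔-by-refutation R-irrefl ¬Adjacent-0-0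
    Chordless⇒NonSelfTouching (extend x~y _ _) zero (suc zero) =
      mk⇔ (const (inj₁ refl)) (const x~y)
    Chordless⇒NonSelfTouching (extend x~y _ _) (suc zero) zero =
      mk⇔ (const (inj₂ refl)) (const (R-sym x~y))
    Chordless⇒NonSelfTouching (extend _ x≁zs _) zero (suc (suc k)) =
      ⇔-by-refutation (All.lookup x≁zs (∈-lookup k)) ¬Adjacent-0-2+
    Chordless⇒NonSelfTouching (extend _ x≁zs _) (suc (suc k)) zero =
      ⇔-by-refutation (All.lookup x≁zs (∈-lookup k) ∘ R-sym) (¬Adjacent-0-2+ ∘ Sum.swap)
    Chordless⇒NonSelfTouching (extend _ _ c) (suc i) (suc j) =
      Adjacent-suc ⇔-∘ Chordless⇒NonSelfTouching c i j

    Chordless⇒NSTPath : ∀ {xs} → Chordless R xs → Unique xs → NSTPath R xs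
    Chordless⇒NSTPath {x ∷ _} c distinct = record
      { path = record { nonempty = s≤s z≤n ; linked = Chordless⇒Linked c ; distinct = distinct }
      ; nst  = Chordless⇒NonSelfTouching c
      }

  module _ (R? : Decidable R) where

    prependChordless : ∀ {x ps} → Any (R x) ps → Chordless R ps →
      ∃ λ zs → zs ⊆ ps × Chordless R (x ∷ zs) × last (x ∷ zs) ≡ last ps
    prependChordless {x} {p ∷ ps} x~ps c with any? (R? x) ps
    prependChordless {x} {p ∷ ps} x~ps (extend _ _ c) | yes x~tail =
      let zs , zs⊆ps , x∷zs , last≡ = prependChordless x~tail c
      in zs , p ∷ʳ zs⊆ps , x∷zs , last≡
    ... | no x≁tail =
      p ∷ ps , ⊆-refl , extend (Any.head x≁tail x~ps) (¬Any⇒All¬ ps x≁tail) c , refl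

    chordlessSubwalk : ∀ {x xs} → Linked R (x ∷ xs) →
      ∃ λ ys → ys ⊆ xs × Chordless R (x ∷ ys) × last (x ∷ ys) ≡ last (x ∷ xs)
    chordlessSubwalk {x} {[]} _ = [] , [] , [ x ] , refl
    chordlessSubwalk {x} {y ∷ xs} (x~y ∷ walk) =
      let ys , ys⊆xs , y∷ys , last-ys = chordlessSubwalk walk
          zs , zs⊆y∷ys , x∷zs , last-zs = prependChordless (here x~y) y∷ys
      in zs , ⊆-trans zs⊆y∷ys (refl ∷ ys⊆xs) , x∷zs , trans last-zs last-ys

module _ (G : PlaneGraph) where
  open PlaneGraph G

  _≟_ : DecidableEquality V
  _≟_ = via-injection (↔⇒↣ enum) ℕ._≟_

  Diagonal : V → V → Set
  Diagonal u v = Σ Face λ F → NonTriangular F × u ∈ boundary F × v ∈ boundary F × u ≢ v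

  Diagonal⇔ : ∀ {u v} →
    (u ≢ v × Any (λ F → NonTriangular F × v ∈ boundary F) (facesAt u)) ⇔ Diagonal u v
  Diagonal⇔ {u} = mk⇔
    (λ (u≢v , F-any) →
      let F , F∈ , nt , v∈F = find F-any
      in F , nt , Equivalence.from (facesAt-spec u F) F∈ , v∈F , u≢v)
    (λ (F , nt , u∈F , v∈F , u≢v) →
      u≢v , lose (Equivalence.to (facesAt-spec u F) u∈F) (nt , v∈F))

  ~*? : Decidable _~*_
  ~*? u v = Dec.map (⇔-sym (nbrs-spec u v)) (v ∈? nbrs u)
    ⊎-dec Dec.map Diagonal⇔ (¬? (u ≟ v) ×-dec any? onFaceWith-v (facesAt u))
    where
    open DecMembership _≟_ using (_∈?_)
    onFaceWith-v : ∀ F → Dec (NonTriangular F × v ∈ boundary F)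
    onFaceWith-v F = ¬? (length (boundary F) ℕ.≟ 3) ×-dec (v ∈? boundary F)

  ~*-sym : Symmetric _~*_
  ~*-sym (inj₁ u~v) = inj₁ (~-sym u~v)
  ~*-sym (inj₂ (F , nt , u∈F , v∈F , u≢v)) = inj₂ (F , nt , v∈F , u∈F , u≢v ∘ sym)

  ~*-irrefl : ∀ {u} → ¬ (u ~* u)
  ~*-irrefl (inj₁ u~u) = ~-irrefl u~u
  ~*-irrefl (inj₂ (_ , _ , _ , _ , u≢u)) = u≢u refl

  facialPath⇒matchingWalk : ∀ {u b rest} →
    Linked _~̂_ (inj₁ u ∷ rest) → Unique (inj₁ u ∷ rest) → last (inj₁ u ∷ rest) ≡ just (inj₁ b) →
    ∃ λ ws → Linked _~*_ (u ∷ ws) × map inj₁ ws ⊆ rest × last (u ∷ ws) ≡ just b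
  facialPath⇒matchingWalk {rest = []} _ _ refl = [] , [-] , [] , refl
  facialPath⇒matchingWalk {rest = inj₁ v ∷ _} (u~v ∷ walk) (_ ∷ distinct) last≡ =
    let ws , ws-walk , ws⊆ , ws-last = facialPath⇒matchingWalk walk distinct last≡
    in v ∷ ws , inj₁ u~v ∷ ws-walk , refl ∷ ws⊆ , ws-last
  facialPath⇒matchingWalk {rest = inj₂ _ ∷ []} _ _ ()
  facialPath⇒matchingWalk {rest = inj₂ _ ∷ inj₂ _ ∷ _} (_ ∷ () ∷ _) _ _
  facialPath⇒matchingWalk {rest = inj₂ (F , nt) ∷ inj₁ v ∷ _}
    (u∈F ∷ v∈F ∷ walk) ((_ ∷ u≢v ∷ _) ∷ _ ∷ distinct) last≡ =
    let ws , ws-walk , ws⊆ , ws-last = facialPath⇒matchingWalk walk distinct last≡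
    in v ∷ ws , inj₂ (F , nt , u∈F , v∈F , u≢v ∘ cong inj₁) ∷ ws-walk ,
       inj₂ (F , nt) ∷ʳ refl ∷ ws⊆ , ws-last

lemma4p3 : (G : PlaneGraph) → let open PlaneGraph G in
    (ν̂ : List V̂) → NSTPath _~̂_ ν̂ →
    (a b : V) → head ν̂ ≡ just (inj₁ a) → last ν̂ ≡ just (inj₁ b) →
    ∃ λ (ν : List V) → map inj₁ ν ⊆ ν̂ × head ν ≡ just a × last ν ≡ just b × NSTPath _~*_ ν
lemma4p3 G (_ ∷ ν̂) ν̂-nst a b refl ν̂-last =
  let open NSTPath ν̂-nst using (path)
      open IsPath path using (linked; distinct)
      ws , ws-walk , ws⊆ν̂ , ws-last = facialPath⇒matchingWalk G linked distinct ν̂-last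
      ys , ys⊆ws , a∷ys , ys-last = chordlessSubwalk (~*? G) ws-walk
      ν⊆ν̂ = refl ∷ ⊆-trans (map⁺ inj₁ ys⊆ws) ws⊆ν̂
  in a ∷ ys , ν⊆ν̂ , refl , trans ys-last ws-last ,
     Chordless⇒NSTPath (~*-sym G) (~*-irrefl G) a∷ys
       (Unique.map⁻ (AllPairs-resp-⊆ ν⊆ν̂ distinct))
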